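{- Let $N$ be a net. Every infinite path of $N$ is embellished by a complete path of $N$.
   Context: Actions $Act=H\uplus O\uplus\{\tau\}$; actions in $O\cup\{\tau\}$ are non-blocking. Multisets over $X$ are functions $X\to\mathbb N$ with pointwise $\le$, $+$, $-$, $\cap$. A labelled Petri net is $N=(S,T,F,M_0,\ell)$ with places $S$, transitions $T$ (disjoint), $F:(S\times T)\cup(T\times S)\to\mathbb N$, initial marking $M_0$, labelling $\ell:T\to Act$. ${}^\bullet u(s)=F(s,u)$, $u^\bullet(s)=F(u,s)$; $M[u\rangle$ iff ${}^\bullet u\le M$, giving $M[u\rangle M'$ with $M'=M-{}^\bullet u+u^\bullet$. A path is $M_0u_1M_1u_2\dots$ starting at the initial marking, infinite or ending in a marking, with $M_k[u_{k+1}\rangle M_{k+1}$; markings on paths are reachable. A net means a structural conflict net (${}^\bullet u+{}^\bullet v\le M$ implies ${}^\bullet u\cap{}^\bullet v=\emptyset$ for reachable $M$) with ${}^\bullet u\neq\emptyset$ for all $u$ and all reachable markings finite. The firing sequence of a path is its sequence of transitions. A firing sequence $v_1v_2\dots$ embellishes a firing sequence $u_1u_2\dots$ if there is a strictly increasing $f:\mathbb N\to\mathbb N$ with $v_{f(i)}=u_i$ for all $i>0$ and $\ell(v_j)\in O\cup\{\tau\}$ for every index $j$ not of the form $f(i)$; a path embellishes another path if its firing sequence embellishes that of the other. On a path $M_0u_1M_1\dots$, a transition $v$ is continuously enabled from position $k$ onwards if $M_k[v\rangle$ and ${}^\bullet v\cap{}^\bullet u_i=\emptyset$ for all $i>k$,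 and then the path is $\ell(v)$-enabled. A path is complete if it is $o$-enabled for no $o\in O\cup\{\tau\}$. -}

module Defs where

open import Data.Nat using (ℕ; zero; suc; _+_; _∸_; _≤_; _<_; _⊓_)
open import Data.Maybe using (Maybe; just; nothing)
open import Data.Product using (Σ; _×_; _,_; ∃)
open import Data.Sum using (_⊎_; inj₁; inj₂)
open import Data.Unit using (⊤; tt)
open import Data.Empty using (⊥)
open import Data.List using (List)
open import Data.List.Membership.Propositional using (_∈_)
open import Relation.Nullary using (¬_)
open import Relation.Binary.PropositionalEquality using (_≡_; _≢_)

data Act (H O : Set) : Set where
  hact : H → Act H O
  oact : O → Act H O
  τ    : Act H O

NonBlocking : {H O : Set} → Act H O → Set
NonBlocking (hact _) = ⊥
NonBlocking (oact _) = ⊤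
NonBlocking τ        = ⊤

Multiset : Set → Set
Multiset X = X → ℕ

_≤ᴹ_ : {X : Set} → Multiset X → Multiset X → Set
A ≤ᴹ B = ∀ x → A x ≤ B x

_+ᴹ_ : {X : Set} → Multiset X → Multiset X → Multiset X
(A +ᴹ B) x = A x + B x

_-ᴹ_ : {X : Set} → Multiset X → Multiset X → Multiset X
(A -ᴹ B) x = A x ∸ B x

_∩ᴹ_ : {X : Set} → Multiset X → Multiset X → Multiset X
(A ∩ᴹ B) x = A x ⊓ B x

∅ᴹ : {X : Set} → Multiset X
∅ᴹ _ = 0

_≈ᴹ_ : {X : Set} → Multiset X → Multiset X → Set
A ≈ᴹ B = ∀ x → A x ≡ B x

FiniteMS : {X : Set} → Multiset X → Set
FiniteMS {X} A = Σ (List X) λ xs → ∀ x → A x ≢ 0 → x ∈ xs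

-- Labelled Petri nets  N = (S, T, F, M₀, ℓ), with F split into
-- Fin : S × T → ℕ  (F(s,u))  and  Fout : T × S → ℕ  (F(u,s)).

record PetriNet (H O : Set) : Set₁ where
  field
    S    : Set
    T    : Set
    Fin  : S → T → ℕ
    Fout : T → S → ℕ
    M₀   : Multiset S
    ℓ    : T → Act H O

  Marking : Set
  Marking = Multiset S

  pre : T → Marking
  pre u s = Fin s u

  post : T → Marking
  post u s = Fout u s

  Enabled : Marking → T → Set
  Enabled M u = pre u ≤ᴹ M

  Step : Marking → T → Marking → Set
  Step M u M' = Enabled M u × (M' ≈ᴹ ((M -ᴹ pre u) +ᴹ post u))

  data Reachable : Marking → Set where
    init : ∀ {M} → M ≈ᴹ M₀ → Reachable M
    step : ∀ {M u M'} → Reachable M → Step M u M' → Reachable M'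

record IsNet {H O : Set} (N : PetriNet H O) : Set where
  open PetriNet N
  field
    structuralConflict : ∀ M u v → Reachable M → (pre u +ᴹ pre v) ≤ᴹ M →
                         (pre u ∩ᴹ pre v) ≈ᴹ ∅ᴹ
    presetNonempty     : ∀ u → ¬ (pre u ≈ᴹ ∅ᴹ)
    reachableFinite    : ∀ M → Reachable M → FiniteMS M

-- Lengths of paths: a path has length  just n  (n transitions, ending in
-- marking M_n) or  nothing  (infinite).

Length : Set
Length = Maybe ℕ

-- k <ᴸ len : the k-th transition (0-based) exists
_<ᴸ_ : ℕ → Length → Set
k <ᴸ nothing = ⊤
k <ᴸ just n  = k < n

-- k ≤ᴸ len : the k-th marking exists
_≤ᴸ_ : ℕ → Length → Set
k ≤ᴸ nothing = ⊤
k ≤ᴸ just n  = k ≤ n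

module _ {H O : Set} (N : PetriNet H O) where
  open PetriNet N

  -- A path  M₀ u₁ M₁ u₂ M₂ …  is represented by
  --   marking k = M_k       (for k ≤ᴸ len)
  --   trans   k = u_{k+1}   (for k <ᴸ len)
  -- values outside these ranges are irrelevant.
  record Path : Set where
    field
      len     : Length
      marking : ℕ → Marking
      trans   : ℕ → T
      start   : marking 0 ≈ᴹ M₀
      steps   : ∀ k → k <ᴸ len → Step (marking k) (trans k) (marking (suc k))

  open Path

  Infinite : Path → Set
  Infinite P = len P ≡ nothing

  Embellishes : Path → Path → Set
  Embellishes Q P =
    Σ (ℕ → ℕ) λ f →
        (∀ i j → i < j → f i < f j)
      × (∀ i → i <ᴸ len P → (f i <ᴸ len Q) × (trans Q (f i) ≡ trans P i))
      × (∀ j → j <ᴸ len Q → ¬ (Σ ℕ λ i → (i <ᴸ len P) × (f i ≡ j)) →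
           NonBlocking (ℓ (trans Q j)))

  ContinuouslyEnabled : Path → T → ℕ → Set
  ContinuouslyEnabled P v k =
      (k ≤ᴸ len P)
    × Enabled (marking P k) v
    × (∀ j → k ≤ j → j <ᴸ len P → (pre v ∩ᴹ pre (trans P j)) ≈ᴹ ∅ᴹ)

  ActEnabled : Path → Act H O → Set
  ActEnabled P a = Σ T λ v → (ℓ v ≡ a) × Σ ℕ λ k → ContinuouslyEnabled P v k

  Complete : Path → Set
  Complete P = ∀ a → NonBlocking a → ¬ ActEnabled P a

module Submission where

-- Q is built step by step while replaying P.  Besides the current marking
-- the construction keeps a position k in P and a budget of tokens.  A
-- transition w is independent from position k on if its label is
-- non-blocking and its preset is disjoint from the presets of all
-- transitions u_i, i ≥ k, of P.  If an independent transition fits in the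
-- budget it is fired and paid from the budget; otherwise u_k is replayed
-- and the budget is refilled with the whole new marking.  Budgets shrink
-- strictly and stay finite, so every phase ends with a replay of P; the
-- i-th replay places u_i into Q, which gives the embellishment.  A
-- non-blocking transition continuously enabled on Q would, after the next
-- replay, stay inside the budget and be independent, so the phase after
-- it could not end: Q is complete.

open import Defs
open import Axiom.ExcludedMiddle using (ExcludedMiddle)
open import Level using (0ℓ)
open import Data.Nat using (ℕ; zero; suc; _+_; _∸_; _≤_; _<_; _⊓_; _≤′_; ≤′-refl; ≤′-step; z≤n; s≤s)
open import Data.Nat.Properties
open import Data.Nat.Induction using (<-wellFounded)
open import Data.Maybe using (just; nothing)
open import Data.Product using (Σ; _×_; _,_; proj₁; proj₂)
open import Data.Sum using (_⊎_; inj₁; inj₂)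
open import Data.Unit using (tt)
open import Data.List using (List; []; _∷_)
open import Data.List.Membership.Propositional using (_∈_)
open import Data.List.Relation.Unary.Any using (here; there)
open import Induction.WellFounded using (Acc; acc)
open import Relation.Nullary using (¬_; Dec; yes; no; contradiction)
open import Relation.Nullary.Decidable using (¬?)
open import Relation.Binary using (tri<; tri≈; tri>)
open import Relation.Binary.PropositionalEquality
  using (_≡_; _≢_; refl; sym; trans; cong; subst; module ≡-Reasoning)

Disjoint : {X : Set} → Multiset X → Multiset X → Set
Disjoint A B = (A ∩ᴹ B) ≈ᴹ ∅ᴹ

_⊂ᴹ_ : {X : Set} → Multiset X → Multiset X → Set
_⊂ᴹ_ {X} A B = A ≤ᴹ B × Σ X λ x → A x < B x

SupportedBy : {X : Set} → List X → Multiset X → Set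
SupportedBy xs A = ∀ x → A x ≢ 0 → x ∈ xs

≤-∸-disjoint : ∀ {a m} b → a ≤ m → a ⊓ b ≡ 0 → a ≤ m ∸ b
≤-∸-disjoint {zero}  b       _   _  = z≤n
≤-∸-disjoint {suc a} zero    a≤m _  = a≤m
≤-∸-disjoint {suc a} (suc b) _   ()

⊓≡0⇒≡0 : ∀ {a b} → a ⊓ b ≡ 0 → a ≢ 0 → b ≡ 0
⊓≡0⇒≡0 {zero}          _ a≢0 = contradiction refl a≢0
⊓≡0⇒≡0 {suc a} {zero}  _ _   = refl
⊓≡0⇒≡0 {suc a} {suc b} ()

≤ᴹ-∸-disjoint : {X : Set} {A M B : Multiset X} →
                A ≤ᴹ M → Disjoint A B → A ≤ᴹ (M -ᴹ B)
≤ᴹ-∸-disjoint {B = B} A≤M A#B x = ≤-∸-disjoint (B x) (A≤M x) (A#B x)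

supported-≤ᴹ : {X : Set} {xs : List X} {A B : Multiset X} →
               A ≤ᴹ B → SupportedBy xs B → SupportedBy xs A
supported-≤ᴹ {A = A} A≤B sup x Ax≢0 =
  sup x λ Bx≡0 → Ax≢0 (n≤0⇒n≡0 (subst (A x ≤_) Bx≡0 (A≤B x)))

finite-≤ᴹ : {X : Set} {A B : Multiset X} → A ≤ᴹ B → FiniteMS B → FiniteMS A
finite-≤ᴹ A≤B (xs , sup) = xs , supported-≤ᴹ A≤B sup

nonempty-element : ExcludedMiddle 0ℓ → {X : Set} {A : Multiset X} →
                   ¬ (A ≈ᴹ ∅ᴹ) → Σ X λ x → A x ≢ 0
nonempty-element lem {X} {A} A≉∅ with lem {Σ X λ x → A x ≢ 0}
... | yes element = element
... | no  none    = contradiction empty A≉∅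
  where
  empty : A ≈ᴹ ∅ᴹ
  empty x with A x ≟ 0
  ... | yes Ax≡0 = Ax≡0
  ... | no  Ax≢0 = contradiction (x , Ax≢0) none

∸-⊂ᴹ : ExcludedMiddle 0ℓ → {X : Set} {A B : Multiset X} →
       B ≤ᴹ A → ¬ (B ≈ᴹ ∅ᴹ) → (A -ᴹ B) ⊂ᴹ A
∸-⊂ᴹ lem {A = A} {B} B≤A B≉∅ with nonempty-element lem B≉∅
... | x , Bx≢0 = (λ y → m∸n≤m (A y) (B y)) , x , ∸-monoʳ-< (n≢0⇒n>0 Bx≢0) (B≤A x)

-- Total multiplicity of the elements listed in xs; it measures the descent.
weight : {X : Set} → List X → Multiset X → ℕ
weight []       A = 0
weight (x ∷ xs) A = A x + weight xs A

weight-mono : {X : Set} (xs : List X) {A B : Multiset X} → A ≤ᴹ B → weight xs A ≤ weight xs B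
weight-mono []       A≤B = z≤n
weight-mono (x ∷ xs) A≤B = +-mono-≤ (A≤B x) (weight-mono xs A≤B)

weight-< : {X : Set} (xs : List X) {A B : Multiset X} {y : X} →
           A ≤ᴹ B → y ∈ xs → A y < B y → weight xs A < weight xs B
weight-< (x ∷ xs) A≤B (here refl) lt = +-mono-<-≤ lt (weight-mono xs A≤B)
weight-< (x ∷ xs) A≤B (there y∈xs) lt = +-mono-≤-< (A≤B x) (weight-< xs A≤B y∈xs lt)

record NextOccurrence (B : ℕ → Set) (n : ℕ) : Set where
  constructor next
  field
    at    : ℕ
    after : n ≤ at
    holds : B at
    first : ∀ j → n ≤ j → j < at → ¬ B j
open NextOccurrence

occurrence-back : ∀ {B n} → ¬ B n → NextOccurrence B (suc n) → NextOccurrence B n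
occurrence-back {n = n} ¬Bn (next m n<m Bm gap) = next m (<⇒≤ n<m) Bm gap′
  where
  gap′ : ∀ j → n ≤ j → j < m → ¬ _
  gap′ j n≤j j<m with m≤n⇒m<n∨m≡n n≤j
  ... | inj₁ n<j  = gap j n<j j<m
  ... | inj₂ refl = ¬Bn

stop-reached : {X : Set} (R : ℕ → Multiset X) (Stop : ℕ → Set) →
               (∀ m → Dec (Stop m)) → (∀ m → ¬ Stop m → R (suc m) ⊂ᴹ R m) →
               ∀ n → FiniteMS (R n) → NextOccurrence Stop n
stop-reached R Stop stop? shrinks n (xs , sup) = go n sup (<-wellFounded (weight xs (R n)))
  where
  go : ∀ m → SupportedBy xs (R m) → Acc _<_ (weight xs (R m)) → NextOccurrence Stop m
  go m sup (acc smaller) with stop? m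
  ... | yes stop = next m ≤-refl stop λ j m≤j j<m → contradiction (≤-<-trans m≤j j<m) (n≮n m)
  ... | no ¬stop with shrinks m ¬stop
  ...   | R′≤R , y , R′y<Ry =
    occurrence-back ¬stop
      (go (suc m) (supported-≤ᴹ R′≤R sup)
          (smaller (weight-< xs R′≤R (sup y (m<n⇒n≢0 R′y<Ry)) R′y<Ry)))

module Ticks (k : ℕ → ℕ) (B : ℕ → Set) (B? : ∀ n → Dec (B n))
             (tick : ∀ n → B n → k (suc n) ≡ suc (k n))
             (idle : ∀ n → ¬ B n → k (suc n) ≡ k n)
             (k-start : k 0 ≡ 0)
             (ticks-recur : ∀ n → NextOccurrence B n) where

  k-mono : ∀ {m n} → m ≤′ n → k m ≤ k n
  k-mono ≤′-refl             = ≤-refl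
  k-mono (≤′-step {n} m≤n) with B? n
  ... | yes Bn = ≤-trans (k-mono m≤n) (≤-trans (n≤1+n _) (≤-reflexive (sym (tick n Bn))))
  ... | no ¬Bn = ≤-trans (k-mono m≤n) (≤-reflexive (sym (idle n ¬Bn)))

  k-idle : ∀ {n m} → n ≤′ m → (∀ j → n ≤ j → j < m → ¬ B j) → k m ≡ k n
  k-idle ≤′-refl               _   = refl
  k-idle (≤′-step {m} n≤m) gap =
    trans (idle m (gap m (≤′⇒≤ n≤m) ≤-refl))
          (k-idle n≤m λ j n≤j j<m → gap j n≤j (m<n⇒m<1+n j<m))

  idle-until : ∀ {n} (r : NextOccurrence B n) → k (at r) ≡ k n
  idle-until r = k-idle (≤⇒≤′ (after r)) (first r)

  tick-raises : ∀ {m n} → B m → m < n → suc (k m) ≤ k n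
  tick-raises {m} {n} Bm m<n = subst (_≤ k n) (tick m Bm) (k-mono (≤⇒≤′ m<n))

  nth : ℕ → ℕ
  nth zero    = at (ticks-recur 0)
  nth (suc i) = at (ticks-recur (suc (nth i)))

  nth-tick : ∀ i → B (nth i)
  nth-tick zero    = holds (ticks-recur 0)
  nth-tick (suc i) = holds (ticks-recur (suc (nth i)))

  nth-suc : ∀ i → nth i < nth (suc i)
  nth-suc i = after (ticks-recur (suc (nth i)))

  count-nth : ∀ i → k (nth i) ≡ i
  count-nth zero    = trans (idle-until (ticks-recur 0)) k-start
  count-nth (suc i) = begin
    k (nth (suc i))   ≡⟨ idle-until (ticks-recur (suc (nth i))) ⟩
    k (suc (nth i))   ≡⟨ tick (nth i) (nth-tick i) ⟩
    suc (k (nth i))   ≡⟨ cong suc (count-nth i) ⟩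
    suc i             ∎
    where open ≡-Reasoning

  nth-mono : ∀ {i j} → i < j → nth i < nth j
  nth-mono {i} i<j = go (≤⇒≤′ i<j)
    where
    go : ∀ {j} → suc i ≤′ j → nth i < nth j
    go ≤′-refl      = nth-suc i
    go (≤′-step {j} p) = <-trans (go p) (nth-suc j)

  nth-inflationary : ∀ i → i ≤ nth i
  nth-inflationary zero    = z≤n
  nth-inflationary (suc i) = ≤-trans (s≤s (nth-inflationary i)) (nth-suc i)

  nth-unique : ∀ {j} → B j → nth (k j) ≡ j
  nth-unique {j} Bj with <-cmp (nth (k j)) j
  ... | tri≈ _ same _ = same
  ... | tri< earlier _ _ =
    contradiction (subst (λ c → suc c ≤ k j) (count-nth (k j)) (tick-raises (nth-tick (k j)) earlier))
                  (n≮n (k j))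
  ... | tri> _ _ later =
    contradiction (subst (suc (k j) ≤_) (count-nth (k j)) (tick-raises Bj later)) (n≮n (k j))

<ᴸ⇒≤ᴸ : ∀ {n} len → n <ᴸ len → n ≤ᴸ len
<ᴸ⇒≤ᴸ nothing  _ = tt
<ᴸ⇒≤ᴸ (just _)   = <⇒≤

suc-≤ᴸ⇒<ᴸ : ∀ {n} len → suc n ≤ᴸ len → n <ᴸ len
suc-≤ᴸ⇒<ᴸ nothing  _   = tt
suc-≤ᴸ⇒<ᴸ (just _) n<m = n<m

module NetFacts {H O : Set} (N : PetriNet H O) where
  open PetriNet N
  open Path

  fire : Marking → T → Marking
  fire M t = (M -ᴹ pre t) +ᴹ post t

  step-keeps-enabled : ∀ {M u M′ v} → Step M u M′ → Disjoint (pre v) (pre u) →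
                       Enabled M v → Enabled M′ v
  step-keeps-enabled {u = u} {v = v} (_ , M′≈) v#u v≤M x =
    subst (pre v x ≤_) (sym (M′≈ x))
          (≤-trans (≤-∸-disjoint (pre u x) (v≤M x) (v#u x)) (m≤m+n _ _))

  path-reachable : (Q : Path N) → ∀ n → n ≤ᴸ len Q → Reachable (marking Q n)
  path-reachable Q zero    _    = init (start Q)
  path-reachable Q (suc n) n<ᴸ′ = step (path-reachable Q n (<ᴸ⇒≤ᴸ (len Q) n<ᴸ)) (steps Q n n<ᴸ)
    where n<ᴸ = suc-≤ᴸ⇒<ᴸ (len Q) n<ᴸ′

  stays-enabled : (Q : Path N) {v : T} {k n : ℕ} → ContinuouslyEnabled N Q v k →
                  k ≤′ n → n ≤ᴸ len Q → Enabled (marking Q n) v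
  stays-enabled Q (_ , enabled , _) ≤′-refl _ = enabled
  stays-enabled Q ce@(_ , _ , disjoint) (≤′-step {n} k≤n) n<ᴸ′ =
    step-keeps-enabled (steps Q n n<ᴸ) (disjoint n (≤′⇒≤ k≤n) n<ᴸ)
                       (stays-enabled Q ce k≤n (<ᴸ⇒≤ᴸ (len Q) n<ᴸ))
    where n<ᴸ = suc-≤ᴸ⇒<ᴸ (len Q) n<ᴸ′

module Scheduler (lem : ExcludedMiddle 0ℓ) {H O : Set} (N : PetriNet H O)
                 (isNet : IsNet N) (P : Path N) (P-infinite : Infinite N P) where
  open PetriNet N
  open IsNet isNet
  open Path using (len; marking; start; steps)
  open NetFacts N

  -- u i is the (i+1)-st transition of P.
  u : ℕ → T
  u = Path.trans P

  P-long : ∀ i → i <ᴸ len P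
  P-long i = subst (i <ᴸ_) (sym P-infinite) tt

  P-step : ∀ i → Step (marking P i) (u i) (marking P (suc i))
  P-step i = steps P i (P-long i)

  Independent : ℕ → T → Set
  Independent k w = NonBlocking (ℓ w) × (∀ i → k ≤ i → Disjoint (pre w) (pre (u i)))

  record State : Set where
    constructor ⟨_,_,_⟩
    field
      pos    : ℕ        -- u pos is the next transition of P to replay
      mark   : Marking  -- the current marking of Q
      budget : Marking  -- tokens still available to independent transitions
  open State

  Spare : State → Set
  Spare s = Σ T λ w → Independent (pos s) w × pre w ≤ᴹ budget s

  data Move (s : State) : T → State → Set where
    spare   : ∀ w → Independent (pos s) w → pre w ≤ᴹ budget s →
              Move s w ⟨ pos s , fire (mark s) w , budget s -ᴹ pre w ⟩
    advance : ¬ Spare s →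
              Move s (u (pos s)) ⟨ suc (pos s) , fire (mark s) (u (pos s)) , fire (mark s) (u (pos s)) ⟩

  Covers : ℕ → Marking → Set
  Covers k M = ∀ x → marking P k x ≤ M x ⊎ (∀ i → k ≤ i → pre (u i) x ≡ 0)

  Inv : State → Set
  Inv s = budget s ≤ᴹ mark s × Covers (pos s) (mark s)

  covers-spare : ∀ {k M w} → Covers k M → Independent k w → Covers k (fire M w)
  covers-spare {M = M} {w} covers (_ , w#P) x with pre w x ≟ 0 | covers x
  ... | no w-uses-x   | _            = inj₂ λ i k≤i → ⊓≡0⇒≡0 (w#P i k≤i x) w-uses-x
  ... | yes _         | inj₂ unused  = inj₂ unused
  ... | yes w-skips-x | inj₁ Pk≤M    =
    inj₁ (≤-trans Pk≤M (subst (λ c → M x ≤ M x ∸ c + post w x) (sym w-skips-x) (m≤m+n _ _)))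

  covers-advance : ∀ {k M} → Covers k M → Covers (suc k) (fire M (u k))
  covers-advance {k} {M} covers x with covers x
  ... | inj₁ Pk≤M  = inj₁ (subst (_≤ fire M (u k) x) (sym (proj₂ (P-step k) x))
                               (+-monoˡ-≤ (post (u k) x) (∸-monoˡ-≤ (pre (u k) x) Pk≤M)))
  ... | inj₂ unused = inj₂ λ i k<i → unused i (<⇒≤ k<i)

  move-enabled : ∀ {s t s′} → Inv s → Move s t s′ → Enabled (mark s) t
  move-enabled (b≤M , _) (spare w _ w≤b) x = ≤-trans (w≤b x) (b≤M x)
  move-enabled {s} (_ , covers) (advance _) x with covers x
  ... | inj₁ Pk≤M  = ≤-trans (proj₁ (P-step (pos s)) x) Pk≤M
  ... | inj₂ unused = ≤-trans (≤-reflexive (unused (pos s) ≤-refl)) z≤n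

  move-step : ∀ {s t s′} → Inv s → Move s t s′ → Step (mark s) t (mark s′)
  move-step inv m@(spare _ _ _) = move-enabled inv m , λ _ → refl
  move-step inv m@(advance _)   = move-enabled inv m , λ _ → refl

  move-inv : ∀ {s t s′} → Inv s → Move s t s′ → Inv s′
  move-inv (b≤M , covers) (spare w ind _) =
    (λ x → ≤-trans (∸-monoˡ-≤ (pre w x) (b≤M x)) (m≤m+n _ _)) , covers-spare covers ind
  move-inv (_ , covers) (advance _) = (λ _ → ≤-refl) , covers-advance covers

  advance-pos : ∀ {s t s′} → Move s t s′ → ¬ Spare s → pos s′ ≡ suc (pos s)
  advance-pos (spare w ind fits) stuck = contradiction (w , ind , fits) stuck
  advance-pos (advance _)        _     = refl

  advance-fires : ∀ {s t s′} → Move s t s′ → ¬ Spare s → t ≡ u (pos s)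
  advance-fires (spare w ind fits) stuck = contradiction (w , ind , fits) stuck
  advance-fires (advance _)        _     = refl

  advance-resets : ∀ {s t s′} → Move s t s′ → ¬ Spare s → budget s′ ≡ mark s′
  advance-resets (spare w ind fits) stuck = contradiction (w , ind , fits) stuck
  advance-resets (advance _)        _     = refl

  spare-pos : ∀ {s t s′} → Move s t s′ → ¬ ¬ Spare s → pos s′ ≡ pos s
  spare-pos (spare _ _ _) _      = refl
  spare-pos (advance stuck) some = contradiction stuck some

  spare-nonblocking : ∀ {s t s′} → Move s t s′ → ¬ ¬ Spare s → NonBlocking (ℓ t)
  spare-nonblocking (spare _ (nb , _) _) _ = nb
  spare-nonblocking (advance stuck) some   = contradiction stuck some

  -- Spare moves strictly shrink the budget (presets are nonempty).
  spare-shrinks : ∀ {s t s′} → Move s t s′ → ¬ ¬ Spare s → budget s′ ⊂ᴹ budget s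
  spare-shrinks (spare w _ w≤b) _    = ∸-⊂ᴹ lem w≤b (presetNonempty w)
  spare-shrinks (advance stuck) some = contradiction stuck some

  budget-retains : ∀ {s t s′ v} → Move s t s′ → Disjoint (pre v) (pre t) →
                   pre v ≤ᴹ budget s → pre v ≤ᴹ mark s′ → pre v ≤ᴹ budget s′
  budget-retains (spare _ _ _) v#w v≤b _   = ≤ᴹ-∸-disjoint v≤b v#w
  budget-retains (advance _)   _   _   v≤M = v≤M

  choose : (s : State) → Σ T λ t → Σ State (Move s t)
  choose s with lem {Spare s}
  ... | yes (w , ind , fits) = w , _ , spare w ind fits
  ... | no stuck             = u (pos s) , _ , advance stuck

  run : ℕ → State
  run zero    = ⟨ 0 , M₀ , M₀ ⟩
  run (suc n) = proj₁ (proj₂ (choose (run n)))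

  fired : ℕ → T
  fired n = proj₁ (choose (run n))

  moves : ∀ n → Move (run n) (fired n) (run (suc n))
  moves n = proj₂ (proj₂ (choose (run n)))

  invariant : ∀ n → Inv (run n)
  invariant zero    = (λ _ → ≤-refl) , λ x → inj₁ (≤-reflexive (start P x))
  invariant (suc n) = move-inv (invariant n) (moves n)

  Q : Path N
  Q = record { len = nothing ; marking = λ n → mark (run n) ; trans = fired
             ; start = λ _ → refl ; steps = λ n _ → move-step (invariant n) (moves n) }

  -- Time n is a tick when no independent transition fits: then P advances.
  Stuck : ℕ → Set
  Stuck n = ¬ Spare (run n)

  -- Budgets are finite and shrink between ticks, so ticks recur.
  ticks-recur : ∀ n → NextOccurrence Stuck n
  ticks-recur n =
    stop-reached (λ m → budget (run m)) Stuck (λ _ → ¬? lem) (λ m → spare-shrinks (moves m)) n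
      (finite-≤ᴹ (proj₁ (invariant n)) (reachableFinite _ (path-reachable Q n tt)))

  open Ticks (λ n → pos (run n)) Stuck (λ _ → ¬? lem)
             (λ n → advance-pos (moves n)) (λ n → spare-pos (moves n)) refl ticks-recur

  fired-nth : ∀ i → fired (nth i) ≡ u i
  fired-nth i = trans (advance-fires (moves (nth i)) (nth-tick i)) (cong u (count-nth i))

  embellishes : Embellishes N Q P
  embellishes = nth , (λ _ _ → nth-mono) , (λ i _ → tt , fired-nth i) , inserted-nonblocking
    where
    inserted-nonblocking : ∀ j → j <ᴸ nothing → ¬ (Σ ℕ λ i → (i <ᴸ len P) × (nth i ≡ j)) →
                           NonBlocking (ℓ (fired j))
    inserted-nonblocking j _ not-replayed =
      spare-nonblocking (moves j) λ stuck → not-replayed (pos (run j) , P-long _ , nth-unique stuck)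

  -- A continuously enabled non-blocking v from j would be a spare
  -- transition at the (j+1)-st tick.
  complete : Complete N Q
  complete a a-nonblocking (v , ℓv≡a , j , ce@(_ , _ , v#Q)) =
    nth-tick (suc j) (v , independent , budgeted (≤⇒≤′ (nth-suc j)))
    where
    enabled : ∀ {n} → j ≤′ n → pre v ≤ᴹ mark (run n)
    enabled j≤n = stays-enabled Q ce j≤n tt

    j≤nth : ∀ {i} → j ≤ i → j ≤ nth i
    j≤nth {i} j≤i = ≤-trans j≤i (nth-inflationary i)

    budgeted : ∀ {n} → suc (nth j) ≤′ n → pre v ≤ᴹ budget (run n)
    budgeted ≤′-refl =
      subst (pre v ≤ᴹ_) (sym (advance-resets (moves (nth j)) (nth-tick j)))
            (enabled (≤′-step (≤⇒≤′ (j≤nth ≤-refl))))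
    budgeted (≤′-step {n} p) =
      budget-retains (moves n) (v#Q n j≤n tt) (budgeted p) (enabled (≤′-step (≤⇒≤′ j≤n)))
      where j≤n = ≤-trans (j≤nth ≤-refl) (≤-trans (n≤1+n _) (≤′⇒≤ p))

    independent : Independent (pos (run (nth (suc j)))) v
    independent = subst NonBlocking (sym ℓv≡a) a-nonblocking , λ i after →
      subst (λ t → Disjoint (pre v) (pre t)) (fired-nth i)
            (v#Q (nth i) (j≤nth (≤-trans (n≤1+n j) (subst (_≤ i) (count-nth (suc j)) after))) tt)

lemma3 : ExcludedMiddle 0ℓ →
    {H O : Set} (N : PetriNet H O) → IsNet N →
    (P : Path N) → Infinite N P →
    Σ (Path N) λ Q → Complete N Q × Embellishes N Q P
lemma3 lem N isNet P P-infinite = Q , complete , embellishes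
  where open Scheduler lem N isNet P P-infinite
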